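{- Let $(\mathcal K,r_n)$ be a pre-extender. The symmetry type graph of the universal Cayley extension $\mathcal U(\mathcal K,r_n)$ is isomorphic to $\mathcal K_{r_n}/\heartsuit(\mathcal K,r_n)$.
   Context: An $n$-premaniplex is a graph (semi-edges and parallel edges allowed) whose vertices, called flags, carry a proper edge colouring with colours $0,\dots,n-1$, every flag $\Phi$ having exactly one incident dart of each colour $i$, with other end $r_i\Phi$; one requires $r_ir_jr_ir_j=1$ for $|i-j|>1$. An $n$-maniplex is a connected $n$-premaniplex in which $r_i$ and $r_ir_j$ ($i\neq j$) have no fixed points. Facets are components after deleting colour-$(n-1)$ edges. Automorphisms are colour-preserving graph automorphisms acting on the right; $\Gamma(\cdot)$ denotes the automorphism group. The symmetry type graph of a maniplex $\mathcal M$ is the quotient premaniplex $\mathcal M/\Gamma(\mathcal M)$: vertices are flag orbits, and the orbit of $\Phi$ is $i$-adjacent to the orbit of $r_i\Phi$. A pre-extender $(\mathcal K,r_n)$ is an $n$-maniplex $\mathcal K$ together with a permutation $r_n$ of its flags with $r_n^2=1$ commuting with $r_0,\dots,r_{n-2}$ (so $r_n$ maps each facet $F$ isomorphically onto a facet $r_n(F)$). The pre-extension $\mathcal K_{r_n}$ is the $(n+1)$-premaniplex with the flags and $i$-adjacencies ($i<n$) of $\mathcal K$, where the $n$-adjacent flag of $\Phi$ is $r_n\Phi$. The universal Cayley extension $\mathcal U(\mathcal K,r_n)$ is the maniplex with flags $(\Phi,\gamma)$, $\Phi$ a flag of $\mathcal K$, $\gamma$ in the group $G(\mathcal K,r_n)=\langle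 \alpha_F\ (F \text{ a facet of }\mathcal K) \mid \alpha_F\alpha_{r_n(F)}=1\ \forall F\rangle$, where $(\Phi,\gamma)$ is $i$-adjacent to $(r_i\Phi,\gamma)$ for $i<n$ and $n$-adjacent to $(r_n\Phi,\alpha_F\gamma)$ with $F$ the facet of $\Phi$. A subset $S\subseteq\Gamma(\mathcal K)$ is $r_n$-friendly if for every flag $\Phi$ of $\mathcal K$ and every $\tau\in S$ there is $\bar\tau\in S$ with $r_n(\Phi\tau)=(r_n\Phi)\bar\tau$. $\heartsuit(\mathcal K,r_n)$ denotes the union of all $r_n$-friendly subsets of $\Gamma(\mathcal K)$ (the greatest $r_n$-friendly set; it is a subgroup). For an $r_n$-friendly subgroup $H$, $\mathcal K_{r_n}/H$ is the premaniplex whose vertices are the orbits $\Phi H$, with $\Phi H$ $i$-adjacent to $(r_i\Phi)H$ for $0\le i\le n$ (well defined by friendliness). -}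

module Defs where

open import Level using (Level; _⊔_) renaming (suc to lsuc)
open import Data.Nat using (ℕ; _<_) renaming (suc to nsuc)
open import Data.Fin using (Fin; zero; suc; toℕ)
open import Data.Bool using (Bool; true; false; not)
open import Data.Maybe using (Maybe; just; nothing)
import Data.Maybe as Maybe
open import Data.List using (List; []; _∷_; _++_)
open import Data.Product using (Σ; _×_; _,_)
open import Data.Sum using (_⊎_)
open import Data.Unit using (⊤)
open import Relation.Binary.PropositionalEquality using (_≡_; _≢_)
open import Relation.Binary.Construct.Closure.Equivalence using (EqClosure)

FarApart : ∀ {n} → Fin n → Fin n → Set
FarApart i j = (nsuc (toℕ i) < toℕ j) ⊎ (nsuc (toℕ j) < toℕ i)

FacetColour : ∀ {n} → Fin n → Set
FacetColour {n} i = nsuc (toℕ i) < n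

record Premaniplex (n : ℕ) : Set₁ where
  field
    Flag    : Set
    r       : Fin n → Flag → Flag
    r-invol : ∀ i Φ → r i (r i Φ) ≡ Φ
    r-comm  : ∀ i j → FarApart i j → ∀ Φ → r i (r j (r i (r j Φ))) ≡ Φ

data Reach {n} (M : Premaniplex n) (P : Fin n → Set)
     : Premaniplex.Flag M → Premaniplex.Flag M → Set where
  here : ∀ Φ → Reach M P Φ Φ
  step : ∀ {Φ Ψ} i → P i → Reach M P (Premaniplex.r M i Φ) Ψ → Reach M P Φ Ψ

record Maniplex (n : ℕ) : Set₁ where
  field
    pre : Premaniplex n
  open Premaniplex pre
  field
    connected : ∀ Φ Ψ → Reach pre (λ _ → ⊤) Φ Ψ
    r-fpf     : ∀ i Φ → r i Φ ≢ Φ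
    rr-fpf    : ∀ i j → i ≢ j → ∀ Φ → r i (r j Φ) ≢ Φ

record PreExtender (n : ℕ) : Set₁ where
  field
    K : Maniplex n
  open Maniplex K
  open Premaniplex pre
  field
    rn       : Flag → Flag
    rn-invol : ∀ Φ → rn (rn Φ) ≡ Φ
    rn-comm  : ∀ i → FacetColour i → ∀ Φ → rn (r i Φ) ≡ r i (rn Φ)

-- colour i of Fin (suc n): just j if i is the colour j < n, nothing if i = n
toFinN : ∀ {n} → Fin (nsuc n) → Maybe (Fin n)
toFinN {ℕ.zero} zero = nothing
toFinN {nsuc n} zero = just zero
toFinN {nsuc n} (suc i) = Maybe.map suc (toFinN i)

record SAut {k : ℕ} {a ℓ : Level} (A : Set a) (_≈_ : A → A → Set ℓ)
            (rA : Fin k → A → A) : Set (a ⊔ ℓ) where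
  field
    to      : A → A
    from    : A → A
    to-cong   : ∀ {x y} → x ≈ y → to x ≈ to y
    from-cong : ∀ {x y} → x ≈ y → from x ≈ from y
    to-from : ∀ x → to (from x) ≈ x
    from-to : ∀ x → from (to x) ≈ x
    to-r    : ∀ i x → to (rA i x) ≈ rA i (to x)

-- Isomorphism of the quotient premaniplexes A/~A and B/~B (colours Fin k),
-- given by a map of representatives
QuotIso : ∀ {a b ℓ₁ ℓ₂} (A : Set a) (B : Set b)
          (_~A_ : A → A → Set ℓ₁) (_~B_ : B → B → Set ℓ₂)
          (k : ℕ) (rA : Fin k → A → A) (rB : Fin k → B → B) → Set (a ⊔ b ⊔ ℓ₁ ⊔ ℓ₂)
QuotIso A B _~A_ _~B_ k rA rB =
  Σ (A → B) λ f →
      (∀ x y → x ~A y → f x ~B f y)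
    × (∀ x y → f x ~B f y → x ~A y)
    × (∀ y → Σ A λ x → f x ~B y)
    × (∀ i x → f (rA i x) ~B rB i (f x))

module PE {n : ℕ} (E : PreExtender n) where
  open PreExtender E public
  open Maniplex K public
  open Premaniplex pre public

  SameFacet : Flag → Flag → Set
  SameFacet = Reach pre FacetColour

  -- words in the generators α_F (facet F represented by any of its flags);
  -- (true , Φ) = α_F, (false , Φ) = α_F⁻¹, F the facet of Φ
  Letter : Set
  Letter = Bool × Flag

  inv : Letter → Letter
  inv (b , Φ) = (not b , Φ)

  Word : Set
  Word = List Letter

  data WStep : Word → Word → Set where
    facet : ∀ xs ys b Φ Ψ → SameFacet Φ Ψ →
            WStep (xs ++ (b , Φ) ∷ ys) (xs ++ (b , Ψ) ∷ ys)
    free  : ∀ xs ys l → WStep (xs ++ l ∷ inv l ∷ ys) (xs ++ ys)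
    -- relator α_F α_{r_n(F)} = 1  (Ψ lies in the facet r_n(F))
    rel   : ∀ xs ys Φ Ψ → SameFacet Ψ (rn Φ) →
            WStep (xs ++ (true , Φ) ∷ (true , Ψ) ∷ ys) (xs ++ ys)

  _≈G_ : Word → Word → Set
  _≈G_ = EqClosure WStep

  -- flags of the universal Cayley extension U(K, r_n)
  UFlag : Set
  UFlag = Flag × Word

  _≈U_ : UFlag → UFlag → Set
  (Φ , γ) ≈U (Ψ , δ) = (Φ ≡ Ψ) × (γ ≈G δ)

  uR : Fin (nsuc n) → UFlag → UFlag
  uR i (Φ , γ) with toFinN i
  ... | just j  = (r j Φ , γ)
  ... | nothing = (rn Φ , (true , Φ) ∷ γ)

  -- the pre-extension K_{r_n}
  KrR : Fin (nsuc n) → Flag → Flag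
  KrR i Φ with toFinN i
  ... | just j  = r j Φ
  ... | nothing = rn Φ

  AutU : Set
  AutU = SAut UFlag _≈U_ uR

  AutK : Set
  AutK = SAut Flag _≡_ r

  act : Flag → AutK → Flag
  act Φ τ = SAut.to τ Φ

  Friendly : (AutK → Set) → Set
  Friendly S = ∀ Φ τ → S τ → Σ AutK λ τ̄ → S τ̄ × (rn (act Φ τ) ≡ act (rn Φ) τ̄)

  -- membership in ♡(K, r_n): union of all r_n-friendly subsets
  InHeart : AutK → Set₁
  InHeart τ = Σ (AutK → Set) λ S → Friendly S × S τ

  HeartOrbit : Flag → Flag → Set₁
  HeartOrbit Φ Ψ = Σ AutK λ τ → InHeart τ × (act Φ τ ≡ Ψ)

  UOrbit : UFlag → UFlag → Set
  UOrbit x y = Σ AutU λ σ → SAut.to σ x ≈U y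

{-# OPTIONS --safe #-}
module Submission where

-- The projection (Φ , γ) ↦ Φ is the isomorphism.  An automorphism σ of U maps the
-- layer K × {γ} onto a layer K × {δ}, because colours below n never change the
-- word and K is connected; so σ restricts to an automorphism τ of K, and since
-- the n-edges of U are given by r_n, the automorphisms arising this way form an
-- r_n-friendly set.  Conversely, an element τ of an r_n-friendly set S lifts to
-- U: reading a word letter by letter, friendliness provides the element of S
-- that acts on the next layer.  This is compatible with the relations of
-- G(K, r_n) because an automorphism of the connected K is determined by the
-- image of one flag.  Composing lifts with right translations by G(K, r_n)
-- shows that flags of U whose projections lie in one ♡-orbit lie in one
-- Γ(U)-orbit.

open import Defs
open import Data.Nat using (ℕ; suc)
open import Data.Fin using (Fin; zero; suc; inject₁; fromℕ)
open import Data.Bool using (true; false)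
open import Data.Maybe using (just; nothing)
open import Data.List using ([]; _∷_; _++_)
open import Data.List.Properties using (++-assoc; ++-identityʳ)
open import Data.Product using (Σ; _×_; _,_; proj₁; proj₂; map₂)
open import Relation.Binary.Bundles using (Setoid)
open import Relation.Binary.Structures using (IsEquivalence)
open import Relation.Binary.PropositionalEquality
import Relation.Binary.Construct.Closure.Equivalence as EC
import Relation.Binary.Reasoning.Setoid as SetoidReasoning

toFinN-inject₁ : ∀ {n} (j : Fin n) → toFinN (inject₁ j) ≡ just j
toFinN-inject₁ {suc n} zero = refl
toFinN-inject₁ {suc n} (suc j) rewrite toFinN-inject₁ j = refl

toFinN-fromℕ : ∀ n → toFinN (fromℕ n) ≡ nothing
toFinN-fromℕ ℕ.zero = refl
toFinN-fromℕ (suc n) rewrite toFinN-fromℕ n = refl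

module _ {n} (M : Premaniplex n) {P : Fin n → Set} where
  open Premaniplex M

  Reach-transport : (Q : Flag → Set) → (∀ i → P i → ∀ {Φ} → Q Φ → Q (r i Φ)) →
                    ∀ {Φ Ψ} → Reach M P Φ Ψ → Q Φ → Q Ψ
  Reach-transport Q Q-r (here _)     q = q
  Reach-transport Q Q-r (step i p ρ) q = Reach-transport Q Q-r ρ (Q-r i p q)

  Reach-map : (f : Flag → Flag) → (∀ i → P i → ∀ Φ → f (r i Φ) ≡ r i (f Φ)) →
              ∀ {Φ Ψ} → Reach M P Φ Ψ → Reach M P (f Φ) (f Ψ)
  Reach-map f f-r (here _)         = here _
  Reach-map f f-r (step {Φ} i p ρ) =
    step i p (subst (λ Φ′ → Reach M P Φ′ _) (f-r i p Φ) (Reach-map f f-r ρ))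

module _ {n} (M : Maniplex n) where
  open Maniplex M
  open Premaniplex pre

  commuting-maps-agree : (f g : Flag → Flag) →
                         (∀ i Φ → f (r i Φ) ≡ r i (f Φ)) → (∀ i Φ → g (r i Φ) ≡ r i (g Φ)) →
                         ∀ {Φ} → f Φ ≡ g Φ → ∀ Ψ → f Ψ ≡ g Ψ
  commuting-maps-agree f g f-r g-r {Φ} fΦ≡gΦ Ψ =
    Reach-transport pre (λ X → f X ≡ g X) agree-r (connected Φ Ψ) fΦ≡gΦ
    where
    agree-r : ∀ i → _ → ∀ {X} → f X ≡ g X → f (r i X) ≡ g (r i X)
    agree-r i _ {X} e = trans (f-r i X) (trans (cong (r i) e) (sym (g-r i X)))

module _ {k a ℓ} {A : Set a} {_≈_ : A → A → Set ℓ} {rA : Fin k → A → A}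
         (≈-isEquivalence : IsEquivalence _≈_) where
  private
    module ≈ = IsEquivalence ≈-isEquivalence

    ≈-setoid : Setoid a ℓ
    ≈-setoid = record { isEquivalence = ≈-isEquivalence }

  SAut-id : SAut A _≈_ rA
  SAut-id = record
    { to = λ x → x ; from = λ x → x ; to-cong = λ e → e ; from-cong = λ e → e
    ; to-from = λ _ → ≈.refl ; from-to = λ _ → ≈.refl ; to-r = λ _ _ → ≈.refl }

  -- Diagrammatic order, matching automorphisms acting on the right: first σ, then σ′.
  _⨾_ : SAut A _≈_ rA → SAut A _≈_ rA → SAut A _≈_ rA
  σ ⨾ σ′ = record
    { to        = λ x → S′.to (S.to x)
    ; from      = λ x → S.from (S′.from x)
    ; to-cong   = λ e → S′.to-cong (S.to-cong e)
    ; from-cong = λ e → S.from-cong (S′.from-cong e)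
    ; to-from   = λ x → ≈.trans (S′.to-cong (S.to-from (S′.from x))) (S′.to-from x)
    ; from-to   = λ x → ≈.trans (S.from-cong (S′.from-to (S.to x))) (S.from-to x)
    ; to-r      = λ i x → ≈.trans (S′.to-cong (S.to-r i x)) (S′.to-r i (S.to x))
    }
    where
    module S = SAut σ
    module S′ = SAut σ′

  module _ (rA-cong : ∀ i {x y} → x ≈ y → rA i x ≈ rA i y) where

    from-r : (σ : SAut A _≈_ rA) → ∀ i x → SAut.from σ (rA i x) ≈ rA i (SAut.from σ x)
    from-r σ i x = begin
      from (rA i x)             ≈⟨ from-cong (rA-cong i (to-from x)) ⟨
      from (rA i (to (from x))) ≈⟨ from-cong (to-r i (from x)) ⟨
      from (to (rA i (from x))) ≈⟨ from-to _ ⟩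
      rA i (from x)             ∎
      where
      open SAut σ
      open SetoidReasoning ≈-setoid

    SAut-inverse : SAut A _≈_ rA → SAut A _≈_ rA
    SAut-inverse σ = record
      { to = from ; from = to ; to-cong = from-cong ; from-cong = to-cong
      ; to-from = from-to ; from-to = to-from ; to-r = from-r σ }
      where open SAut σ

module UniversalExtension {n : ℕ} (E : PreExtender n) where
  open PE E

  ≈G-isEquivalence : IsEquivalence _≈G_
  ≈G-isEquivalence = EC.isEquivalence WStep

  module ≈G = IsEquivalence ≈G-isEquivalence
  module ≈G-Reasoning = SetoidReasoning (EC.setoid WStep)

  WStep-∷ : ∀ l {u v} → WStep u v → WStep (l ∷ u) (l ∷ v)
  WStep-∷ l (facet xs ys b Φ Ψ sf) = facet (l ∷ xs) ys b Φ Ψ sf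
  WStep-∷ l (free xs ys l′)        = free (l ∷ xs) ys l′
  WStep-∷ l (rel xs ys Φ Ψ sf)     = rel (l ∷ xs) ys Φ Ψ sf

  WStep-++ʳ : ∀ zs {u v} → WStep u v → WStep (u ++ zs) (v ++ zs)
  WStep-++ʳ zs (facet xs ys b Φ Ψ sf) =
    subst₂ WStep (sym (++-assoc xs _ zs)) (sym (++-assoc xs _ zs)) (facet xs (ys ++ zs) b Φ Ψ sf)
  WStep-++ʳ zs (free xs ys l) =
    subst₂ WStep (sym (++-assoc xs _ zs)) (sym (++-assoc xs ys zs)) (free xs (ys ++ zs) l)
  WStep-++ʳ zs (rel xs ys Φ Ψ sf) =
    subst₂ WStep (sym (++-assoc xs _ zs)) (sym (++-assoc xs ys zs)) (rel xs (ys ++ zs) Φ Ψ sf)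

  ≈G-∷ : ∀ l {u v} → u ≈G v → (l ∷ u) ≈G (l ∷ v)
  ≈G-∷ l = EC.gmap (l ∷_) (WStep-∷ l)

  ≈G-++ʳ : ∀ zs {u v} → u ≈G v → (u ++ zs) ≈G (v ++ zs)
  ≈G-++ʳ zs = EC.gmap (_++ zs) (WStep-++ʳ zs)

  ≈G-++ˡ : ∀ xs {u v} → u ≈G v → (xs ++ u) ≈G (xs ++ v)
  ≈G-++ˡ []       p = p
  ≈G-++ˡ (l ∷ xs) p = ≈G-∷ l (≈G-++ˡ xs p)

  free-inv : ∀ xs ys l → WStep (xs ++ inv l ∷ l ∷ ys) (xs ++ ys)
  free-inv xs ys (true , Φ)  = free xs ys (false , Φ)
  free-inv xs ys (false , Φ) = free xs ys (true , Φ)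

  word⁻¹ : Word → Word
  word⁻¹ []      = []
  word⁻¹ (l ∷ v) = word⁻¹ v ++ inv l ∷ []

  word-inverseʳ : ∀ v → (v ++ word⁻¹ v) ≈G []
  word-inverseʳ []      = ≈G.refl
  word-inverseʳ (l ∷ v) = begin
    l ∷ v ++ word⁻¹ v ++ inv l ∷ []     ≡⟨ cong (l ∷_) (++-assoc v (word⁻¹ v) _) ⟨
    l ∷ (v ++ word⁻¹ v) ++ inv l ∷ []   ≈⟨ ≈G-∷ l (≈G-++ʳ _ (word-inverseʳ v)) ⟩
    l ∷ inv l ∷ []                      ≈⟨ EC.return (free [] [] l) ⟩
    []                                  ∎
    where open ≈G-Reasoning

  word-inverseˡ : ∀ v → (word⁻¹ v ++ v) ≈G []
  word-inverseˡ []      = ≈G.refl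
  word-inverseˡ (l ∷ v) = begin
    (word⁻¹ v ++ inv l ∷ []) ++ l ∷ v   ≡⟨ ++-assoc (word⁻¹ v) _ (l ∷ v) ⟩
    word⁻¹ v ++ inv l ∷ l ∷ v           ≈⟨ EC.return (free-inv (word⁻¹ v) v l) ⟩
    word⁻¹ v ++ v                       ≈⟨ word-inverseˡ v ⟩
    []                                  ∎
    where open ≈G-Reasoning

  -- α_F⁻¹ = α_{r_n(F)}, so every letter is equivalent to a positive one.
  key : Letter → Flag
  key (true , Φ)  = Φ
  key (false , Φ) = rn Φ

  key-∷ : ∀ l v → ((true , key l) ∷ v) ≈G (l ∷ v)
  key-∷ (true , Φ)  v = ≈G.refl
  key-∷ (false , Φ) v = begin
    (true , rn Φ) ∷ v
      ≈⟨ EC.return (free [] ((true , rn Φ) ∷ v) (false , Φ)) ⟨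
    (false , Φ) ∷ (true , Φ) ∷ (true , rn Φ) ∷ v
      ≈⟨ EC.return (rel ((false , Φ) ∷ []) v Φ (rn Φ) (here _)) ⟩
    (false , Φ) ∷ v
      ∎
    where open ≈G-Reasoning

  SameFacet-rn : ∀ {Φ Ψ} → SameFacet Φ Ψ → SameFacet (rn Φ) (rn Ψ)
  SameFacet-rn = Reach-map pre rn rn-comm

  SameFacet-act : ∀ (τ : AutK) {Φ Ψ} → SameFacet Φ Ψ → SameFacet (act Φ τ) (act Ψ τ)
  SameFacet-act τ = Reach-map pre (λ Φ → act Φ τ) (λ i _ → SAut.to-r τ i)

  SameFacet-key : ∀ b {Φ Ψ} → SameFacet Φ Ψ → SameFacet (key (b , Φ)) (key (b , Ψ))
  SameFacet-key true  sf = sf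
  SameFacet-key false sf = SameFacet-rn sf

  ≈U-isEquivalence : IsEquivalence _≈U_
  ≈U-isEquivalence = record
    { refl  = refl , ≈G.refl
    ; sym   = λ (e , p) → sym e , ≈G.sym p
    ; trans = λ (e , p) (e′ , p′) → trans e e′ , ≈G.trans p p′
    }

  ≈U-setoid : Setoid _ _
  ≈U-setoid = record { isEquivalence = ≈U-isEquivalence }

  module ≈U = IsEquivalence ≈U-isEquivalence
  module ≈U-Reasoning = SetoidReasoning ≈U-setoid

  uR-cong : ∀ i {x y} → x ≈U y → uR i x ≈U uR i y
  uR-cong i {Φ , γ} {.Φ , δ} (refl , p) with toFinN i
  ... | just _  = refl , p
  ... | nothing = refl , ≈G-∷ _ p

  uR-inject₁ : ∀ j Φ γ → uR (inject₁ j) (Φ , γ) ≡ (r j Φ , γ)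
  uR-inject₁ j Φ γ rewrite toFinN-inject₁ j = refl

  uR-fromℕ : ∀ Φ γ → uR (fromℕ n) (Φ , γ) ≡ (rn Φ , (true , Φ) ∷ γ)
  uR-fromℕ Φ γ rewrite toFinN-fromℕ n = refl

  proj₁-uR : ∀ i x → proj₁ (uR i x) ≡ KrR i (proj₁ x)
  proj₁-uR i x with toFinN i
  ... | just _  = refl
  ... | nothing = refl

  Aut-id : AutK
  Aut-id = SAut-id isEquivalence

  Aut-inverse : AutK → AutK
  Aut-inverse = SAut-inverse isEquivalence (λ i → cong (r i))

  translation : Word → AutU
  translation v = record
    { to        = λ (Φ , w) → (Φ , w ++ v)
    ; from      = λ (Φ , w) → (Φ , w ++ word⁻¹ v)
    ; to-cong   = λ (e , p) → e , ≈G-++ʳ v p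
    ; from-cong = λ (e , p) → e , ≈G-++ʳ (word⁻¹ v) p
    ; to-from   = λ (Φ , w) → refl , cancel w (word⁻¹ v) v (word-inverseˡ v)
    ; from-to   = λ (Φ , w) → refl , cancel w v (word⁻¹ v) (word-inverseʳ v)
    ; to-r      = translation-r
    }
    where
    cancel : ∀ w u u′ → (u ++ u′) ≈G [] → ((w ++ u) ++ u′) ≈G w
    cancel w u u′ uu′≈[] = begin
      (w ++ u) ++ u′ ≡⟨ ++-assoc w u u′ ⟩
      w ++ u ++ u′   ≈⟨ ≈G-++ˡ w uu′≈[] ⟩
      w ++ []        ≡⟨ ++-identityʳ w ⟩
      w              ∎
      where open ≈G-Reasoning

    translation-r : ∀ i x → (proj₁ (uR i x) , proj₂ (uR i x) ++ v) ≈U uR i (proj₁ x , proj₂ x ++ v)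
    translation-r i (Φ , w) with toFinN i
    ... | just _  = ≈U.refl
    ... | nothing = ≈U.refl

  module _ (g : UFlag → UFlag) (g-r : ∀ i x → g (uR i x) ≈U uR i (g x)) where

    commutes-below-n : ∀ j Φ w → g (r j Φ , w) ≈U (r j (proj₁ (g (Φ , w))) , proj₂ (g (Φ , w)))
    commutes-below-n j Φ w =
      subst₂ _≈U_ (cong g (uR-inject₁ j Φ w)) (uR-inject₁ j _ _) (g-r (inject₁ j) (Φ , w))

    layer-constant : ∀ {Φ w v} → proj₂ (g (Φ , w)) ≈G v → ∀ Ψ → proj₂ (g (Ψ , w)) ≈G v
    layer-constant {Φ} {w} {v} p Ψ =
      Reach-transport pre (λ X → proj₂ (g (X , w)) ≈G v)
        (λ j _ {X} q → ≈G.trans (proj₂ (commutes-below-n j X w)) q) (connected Φ Ψ) p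

  module Restriction (σ : AutU) {γ δ Φ₀ Ψ₀} (σΦ₀ : SAut.to σ (Φ₀ , γ) ≈U (Ψ₀ , δ)) where
    open SAut σ

    to-layer : ∀ Ψ → proj₂ (to (Ψ , γ)) ≈G δ
    to-layer = layer-constant to to-r (proj₂ σΦ₀)

    from-layer : ∀ Ψ → proj₂ (from (Ψ , δ)) ≈G γ
    from-layer = layer-constant from (from-r ≈U-isEquivalence uR-cong σ)
      (proj₂ (≈U.trans (from-cong (≈U.sym σΦ₀)) (from-to _)))

    restriction : AutK
    restriction = record
      { to        = λ Ψ → proj₁ (to (Ψ , γ))
      ; from      = λ Ψ → proj₁ (from (Ψ , δ))
      ; to-cong   = cong (λ Ψ → proj₁ (to (Ψ , γ)))
      ; from-cong = cong (λ Ψ → proj₁ (from (Ψ , δ)))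
      ; to-from   = λ Ψ → proj₁ (≈U.trans (to-cong (refl , ≈G.sym (from-layer Ψ))) (to-from (Ψ , δ)))
      ; from-to   = λ Ψ → proj₁ (≈U.trans (from-cong (refl , ≈G.sym (to-layer Ψ))) (from-to (Ψ , γ)))
      ; to-r      = λ j Ψ → proj₁ (commutes-below-n to to-r j Ψ γ)
      }

    restriction-spec : ∀ Ψ → to (Ψ , γ) ≈U (act Ψ restriction , δ)
    restriction-spec Ψ = refl , to-layer Ψ

  Induced : AutK → Set
  Induced τ = Σ AutU λ σ → Σ Word λ γ → Σ Word λ δ → ∀ Ψ → SAut.to σ (Ψ , γ) ≈U (act Ψ τ , δ)

  restriction-induced : ∀ σ {γ δ Φ₀ Ψ₀} (σΦ₀ : SAut.to σ (Φ₀ , γ) ≈U (Ψ₀ , δ)) →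
                        Induced (Restriction.restriction σ σΦ₀)
  restriction-induced σ σΦ₀ = σ , _ , _ , Restriction.restriction-spec σ σΦ₀

  -- σ maps the n-neighbour (r_n Φ , α_F γ) of (Φ , γ) to the n-neighbour of (Φτ , δ),
  -- so restricting σ to the layer of α_F γ gives the partner τ̄.
  Induced-friendly : Friendly Induced
  Induced-friendly Φ τ (σ , γ , δ , σ-spec) =
    restriction , restriction-induced σ σrnΦ , sym (proj₁ σrnΦ)
    where
    open SAut σ
    σrnΦ : to (rn Φ , (true , Φ) ∷ γ) ≈U (rn (act Φ τ) , (true , act Φ τ) ∷ δ)
    σrnΦ = begin
      to (rn Φ , (true , Φ) ∷ γ)        ≡⟨ cong to (uR-fromℕ Φ γ) ⟨
      to (uR (fromℕ n) (Φ , γ))         ≈⟨ to-r (fromℕ n) (Φ , γ) ⟩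
      uR (fromℕ n) (to (Φ , γ))         ≈⟨ uR-cong (fromℕ n) (σ-spec Φ) ⟩
      uR (fromℕ n) (act Φ τ , δ)        ≡⟨ uR-fromℕ (act Φ τ) δ ⟩
      (rn (act Φ τ) , (true , act Φ τ) ∷ δ) ∎
      where open ≈U-Reasoning
    open Restriction σ σrnΦ

  module Lift (S : AutK → Set) (S-friendly : Friendly S) where

    Member : Set
    Member = Σ AutK S

    _·_ : Flag → Member → Flag
    Φ · t = act Φ (proj₁ t)

    ·-r : ∀ t i Φ → r i Φ · t ≡ r i (Φ · t)
    ·-r t = SAut.to-r (proj₁ t)

    SameAction : Member → Member → Set
    SameAction t t′ = ∀ Φ → Φ · t ≡ Φ · t′

    SameAction-from : ∀ t t′ {Φ} → Φ · t ≡ Φ · t′ → SameAction t t′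
    SameAction-from t t′ = commuting-maps-agree K (_· t) (_· t′) (·-r t) (·-r t′)

    partner : Member → Flag → Member
    partner (τ , s) X = map₂ proj₁ (S-friendly X τ s)

    partner-spec : ∀ t X → rn (X · t) ≡ rn X · partner t X
    partner-spec (τ , s) X = proj₂ (proj₂ (S-friendly X τ s))

    partner-on-facet : ∀ t {X Z} → SameFacet X Z → rn Z · partner t X ≡ rn (Z · t)
    partner-on-facet t {X} sf = Reach-transport pre Spec Spec-r sf (sym (partner-spec t X))
      where
      t̄ = partner t X
      Spec : Flag → Set
      Spec Z = rn Z · t̄ ≡ rn (Z · t)
      Spec-r : ∀ i → FacetColour i → ∀ {Z} → Spec Z → Spec (r i Z)
      Spec-r i c {Z} e = begin
        rn (r i Z) · t̄     ≡⟨ cong (_· t̄) (rn-comm i c Z) ⟩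
        r i (rn Z) · t̄     ≡⟨ ·-r t̄ i (rn Z) ⟩
        r i (rn Z · t̄)     ≡⟨ cong (r i) e ⟩
        r i (rn (Z · t))   ≡⟨ rn-comm i c (Z · t) ⟨
        rn (r i (Z · t))   ≡⟨ cong rn (·-r t i Z) ⟨
        rn (r i Z · t)     ∎
        where open ≡-Reasoning

    partner-cong : ∀ {t t′} → SameAction t t′ → ∀ X → SameAction (partner t X) (partner t′ X)
    partner-cong {t} {t′} e X = SameAction-from (partner t X) (partner t′ X)
      (trans (sym (partner-spec t X)) (trans (cong rn (e X)) (partner-spec t′ X)))

    partner-facet : ∀ t {X Y} → SameFacet X Y → SameAction (partner t X) (partner t Y)
    partner-facet t {X} {Y} sf = SameAction-from (partner t X) (partner t Y)
      (trans (partner-on-facet t sf) (partner-spec t Y))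

    -- The lift of t₀ maps (Φ , w) to (Φ · aut w , image w).
    module WordLift (t₀ : Member) where

      aut : Word → Member
      aut []      = t₀
      aut (l ∷ w) = partner (aut w) (key l)

      image : Word → Word
      image []      = []
      image (l ∷ w) = (true , key l · aut w) ∷ image w

      Compatible : Word → Word → Set
      Compatible u v = SameAction (aut u) (aut v) × (image u ≈G image v)

      Compatible-isEquivalence : IsEquivalence Compatible
      Compatible-isEquivalence = record
        { refl  = (λ _ → refl) , ≈G.refl
        ; sym   = λ (e , p) → (λ Φ → sym (e Φ)) , ≈G.sym p
        ; trans = λ (e , p) (e′ , p′) → (λ Φ → trans (e Φ) (e′ Φ)) , ≈G.trans p p′
        }

      Compatible-∷ : ∀ l {u v} → Compatible u v → Compatible (l ∷ u) (l ∷ v)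
      Compatible-∷ l {u} {v} (e , p) = partner-cong e (key l) ,
        ≈G.trans (≈G-∷ _ p) (≈G.reflexive (cong (λ Z → (true , Z) ∷ image v) (e (key l))))

      Compatible-++ˡ : ∀ xs {u v} → Compatible u v → Compatible (xs ++ u) (xs ++ v)
      Compatible-++ˡ []       c = c
      Compatible-++ˡ (l ∷ xs) c = Compatible-∷ l (Compatible-++ˡ xs c)

      Compatible-facet : ∀ b {Φ Ψ} → SameFacet Φ Ψ → ∀ ys → Compatible ((b , Φ) ∷ ys) ((b , Ψ) ∷ ys)
      Compatible-facet b sf ys =
        partner-facet (aut ys) (SameFacet-key b sf) ,
        EC.return (facet [] (image ys) true _ _ (SameFacet-act (proj₁ (aut ys)) (SameFacet-key b sf)))

      Compatible-cancel : ∀ l l′ → SameFacet (key l′) (rn (key l)) → ∀ ys → Compatible (l ∷ l′ ∷ ys) ys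
      Compatible-cancel l l′ sf ys = agree , EC.return (rel [] (image ys) _ _ sf′)
        where
        X = key l
        Y = key l′
        t = aut ys
        X-image : X · partner t Y ≡ rn (rn X · t)
        X-image = trans (cong (_· partner t Y) (sym (rn-invol X))) (partner-on-facet t sf)
        agree : SameAction (partner (partner t Y) X) t
        agree = SameAction-from (partner (partner t Y) X) t
          (trans (sym (partner-spec (partner t Y) X)) (trans (cong rn X-image) (rn-invol _)))
        sf′ : SameFacet (Y · t) (rn (X · partner t Y))
        sf′ = subst (SameFacet (Y · t)) (trans (sym (rn-invol _)) (cong rn (sym X-image)))
                (SameFacet-act (proj₁ t) sf)

      Compatible-step : ∀ {u v} → WStep u v → Compatible u v
      Compatible-step (facet xs ys b Φ Ψ sf)   = Compatible-++ˡ xs (Compatible-facet b sf ys)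
      Compatible-step (free xs ys (true , Φ))  =
        Compatible-++ˡ xs (Compatible-cancel (true , Φ) (false , Φ) (here _) ys)
      Compatible-step (free xs ys (false , Φ)) =
        Compatible-++ˡ xs (Compatible-cancel (false , Φ) (true , Φ)
                             (subst (SameFacet Φ) (sym (rn-invol Φ)) (here _)) ys)
      Compatible-step (rel xs ys Φ Ψ sf)       =
        Compatible-++ˡ xs (Compatible-cancel (true , Φ) (true , Ψ) sf ys)

      ≈G⇒Compatible : ∀ {u v} → u ≈G v → Compatible u v
      ≈G⇒Compatible = EC.fold Compatible-isEquivalence Compatible-step

  module LiftInverse {S₁ S₂ : AutK → Set} (fr₁ : Friendly S₁) (fr₂ : Friendly S₂)
                     (t₁ : Σ AutK S₁) (t₂ : Σ AutK S₂)
                     (t₁t₂≗id : ∀ Φ → act (act Φ (proj₁ t₁)) (proj₁ t₂) ≡ Φ) where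
    module A = Lift S₁ fr₁
    module B = Lift S₂ fr₂
    module WA = A.WordLift t₁
    module WB = B.WordLift t₂
    open A using (_·_)
    open B using () renaming (_·_ to _∙_)

    aut-inverse : ∀ w Φ → (Φ · WA.aut w) ∙ WB.aut (WA.image w) ≡ Φ
    aut-inverse []      = t₁t₂≗id
    aut-inverse (l ∷ v) =
      commuting-maps-agree K composite (λ Φ → Φ) composite-r (λ _ _ → refl) composite-rnX
      where
      X = key l
      ρ = WA.aut v
      ρ′ = WB.aut (WA.image v)
      ρ̄ = A.partner ρ X
      ρ̄′ = B.partner ρ′ (X · ρ)
      composite : Flag → Flag
      composite Φ = (Φ · ρ̄) ∙ ρ̄′
      composite-r : ∀ i Φ → composite (r i Φ) ≡ r i (composite Φ)
      composite-r i Φ = trans (cong (_∙ ρ̄′) (A.·-r ρ̄ i Φ)) (B.·-r ρ̄′ i (Φ · ρ̄))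
      composite-rnX : composite (rn X) ≡ rn X
      composite-rnX = begin
        (rn X · ρ̄) ∙ ρ̄′       ≡⟨ cong (_∙ ρ̄′) (A.partner-spec ρ X) ⟨
        rn (X · ρ) ∙ ρ̄′       ≡⟨ B.partner-spec ρ′ (X · ρ) ⟨
        rn ((X · ρ) ∙ ρ′)     ≡⟨ cong rn (aut-inverse v X) ⟩
        rn X                  ∎
        where open ≡-Reasoning

    image-inverse : ∀ w → WB.image (WA.image w) ≈G w
    image-inverse []      = ≈G.refl
    image-inverse (l ∷ v) = begin
      (true , (key l · WA.aut v) ∙ WB.aut (WA.image v)) ∷ WB.image (WA.image v)
        ≡⟨ cong (λ Z → (true , Z) ∷ WB.image (WA.image v)) (aut-inverse v (key l)) ⟩
      (true , key l) ∷ WB.image (WA.image v) ≈⟨ ≈G-∷ _ (image-inverse v) ⟩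
      (true , key l) ∷ v                     ≈⟨ key-∷ l v ⟩
      l ∷ v                                  ∎
      where open ≈G-Reasoning

  Inverses : (AutK → Set) → AutK → Set
  Inverses S ρ = Σ AutK λ σ → S σ × (∀ Φ → act Φ ρ ≡ SAut.from σ Φ)

  Inverses-friendly : ∀ {S} → Friendly S → Friendly (Inverses S)
  Inverses-friendly fr Φ ρ (σ , s , ρ≗σ⁻¹) = Aut-inverse σ̄ , (σ̄ , s̄ , λ _ → refl) , rn-Φρ
    where
    open SAut σ using (from; to-from)
    σ̄ = proj₁ (fr (from Φ) σ s)
    s̄ = proj₁ (proj₂ (fr (from Φ) σ s))
    σ̄-spec = proj₂ (proj₂ (fr (from Φ) σ s))
    rn-Φρ : rn (act Φ ρ) ≡ SAut.from σ̄ (rn Φ)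
    rn-Φρ = begin
      rn (act Φ ρ)                          ≡⟨ cong rn (ρ≗σ⁻¹ Φ) ⟩
      rn (from Φ)                           ≡⟨ SAut.from-to σ̄ _ ⟨
      SAut.from σ̄ (act (rn (from Φ)) σ̄)    ≡⟨ cong (SAut.from σ̄) σ̄-spec ⟨
      SAut.from σ̄ (rn (act (from Φ) σ))    ≡⟨ cong (λ Z → SAut.from σ̄ (rn Z)) (to-from Φ) ⟩
      SAut.from σ̄ (rn Φ)                   ∎
      where open ≡-Reasoning

  lift : ∀ {S} → Friendly S → (τ : AutK) → S τ → AutU
  lift {S} fr τ s = record
    { to        = forward
    ; from      = λ (Φ , w) → (act Φ (proj₁ (WB.aut w)) , WB.image w)
    ; to-cong   = λ { {Φ , _} (refl , p) → let (e , q) = WA.≈G⇒Compatible p in e Φ , q }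
    ; from-cong = λ { {Φ , _} (refl , p) → let (e , q) = WB.≈G⇒Compatible p in e Φ , q }
    ; to-from   = λ (Φ , w) → BA.aut-inverse w Φ , BA.image-inverse w
    ; from-to   = λ (Φ , w) → AB.aut-inverse w Φ , AB.image-inverse w
    ; to-r      = lift-r
    }
    where
    τ⁻¹ : Σ AutK (Inverses S)
    τ⁻¹ = Aut-inverse τ , τ , s , λ _ → refl
    module A = Lift S fr
    module WA = A.WordLift (τ , s)
    module WB = Lift.WordLift (Inverses S) (Inverses-friendly fr) τ⁻¹
    module AB = LiftInverse fr (Inverses-friendly fr) (τ , s) τ⁻¹ (SAut.from-to τ)
    module BA = LiftInverse (Inverses-friendly fr) fr τ⁻¹ (τ , s) (SAut.to-from τ)
    forward : UFlag → UFlag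
    forward (Φ , w) = (Φ A.· WA.aut w , WA.image w)
    lift-r : ∀ i x → forward (uR i x) ≈U uR i (forward x)
    lift-r i (Φ , w) with toFinN i
    ... | just j  = A.·-r (WA.aut w) j Φ , ≈G.refl
    ... | nothing = sym (A.partner-spec (WA.aut w) Φ) , ≈G.refl

  ActsTrivially : AutK → Set
  ActsTrivially τ = ∀ Φ → act Φ τ ≡ Φ

  ActsTrivially-friendly : Friendly ActsTrivially
  ActsTrivially-friendly Φ τ τ≗id = Aut-id , (λ _ → refl) , cong rn (τ≗id Φ)

  HeartOrbit-reflexive : ∀ {Φ Ψ} → Φ ≡ Ψ → HeartOrbit Φ Ψ
  HeartOrbit-reflexive Φ≡Ψ = Aut-id , (ActsTrivially , ActsTrivially-friendly , λ _ → refl) , Φ≡Ψ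

  UOrbit⇒HeartOrbit : ∀ x y → UOrbit x y → HeartOrbit (proj₁ x) (proj₁ y)
  UOrbit⇒HeartOrbit x y (σ , σx≈y) =
    restriction , (Induced , Induced-friendly , restriction-induced σ σx≈y) , proj₁ σx≈y
    where open Restriction σ σx≈y

  _⨾ᵁ_ : AutU → AutU → AutU
  _⨾ᵁ_ = _⨾_ ≈U-isEquivalence

  -- Translate γ away, lift τ on the identity layer, then translate to δ.
  HeartOrbit⇒UOrbit : ∀ x y → HeartOrbit (proj₁ x) (proj₁ y) → UOrbit x y
  HeartOrbit⇒UOrbit (Φ , γ) (Ψ , δ) (τ , (S , fr , s) , Φτ≡Ψ) =
    translation (word⁻¹ γ) ⨾ᵁ (lift fr τ s ⨾ᵁ translation δ) ,
    ≈U.trans (to-cong (translation δ) (to-cong (lift fr τ s) (refl , word-inverseʳ γ))) (Φτ≡Ψ , ≈G.refl)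
    where open SAut using (to-cong)

theorem5p19 : ∀ (n : ℕ) (E : PreExtender n) → let open PE E in
    QuotIso UFlag Flag UOrbit HeartOrbit (suc n) uR KrR
theorem5p19 n E =
  proj₁ ,
  UOrbit⇒HeartOrbit ,
  HeartOrbit⇒UOrbit ,
  (λ Φ → (Φ , []) , HeartOrbit-reflexive refl) ,
  (λ i x → HeartOrbit-reflexive (proj₁-uR i x))
  where open UniversalExtension E
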